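{- Let $G$ be a finite simple graph with minimum degree $\delta(G)\geq 3$. If $G$ does not contain the cycle $C_4$ as a subgraph, then $G$ has an $n$-hole for some $n\geq 5$.
   Context: All graphs are finite and simple. A hole is a chordless cycle (a cycle with no edge joining two non-consecutive vertices of the cycle) of length at least four; an $n$-hole is a hole of length $n$. -}

module Defs where

open import Data.Nat using (ℕ; suc; _+_; _≤_; _%_)
open import Data.Fin using (Fin; toℕ)
open import Data.List using (length; filter)
open import Data.List.Base using (allFin)
open import Data.Product using (Σ; _×_; ∃; ∃-syntax)
open import Data.Sum using (_⊎_)
open import Relation.Nullary using (¬_; Dec)
open import Relation.Binary.PropositionalEquality using (_≡_)
open import Function using (_⇔_)
open import Function.Definitions using (Injective)
open import Level using (0ℓ)

record Graph (n : ℕ) : Set₁ where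
  field
    Adj     : Fin n → Fin n → Set
    adj?    : ∀ u v → Dec (Adj u v)
    sym     : ∀ {u v} → Adj u v → Adj v u
    irrefl  : ∀ {u} → ¬ Adj u u

open Graph public

degree : ∀ {n} → Graph n → Fin n → ℕ
degree G v = length (filter (adj? G v) (allFin _))

MinDegreeAtLeast : ∀ {n} → Graph n → ℕ → Set
MinDegreeAtLeast G d = ∀ v → d ≤ degree G v

ContainsC4 : ∀ {n} → Graph n → Set
ContainsC4 {n} G = Σ (Fin n) λ a → Σ (Fin n) λ b → Σ (Fin n) λ c → Σ (Fin n) λ d →
  (¬ a ≡ b) × (¬ a ≡ c) × (¬ a ≡ d) × (¬ b ≡ c) × (¬ b ≡ d) × (¬ c ≡ d) ×
  Adj G a b × Adj G b c × Adj G c d × Adj G d a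

CycConsec : (k : ℕ) → Fin k → Fin k → Set
CycConsec (suc m) i j = ((toℕ i + 1) % suc m ≡ toℕ j) ⊎ ((toℕ j + 1) % suc m ≡ toℕ i)

HasHole : ∀ {n} → Graph n → ℕ → Set
HasHole {n} G k = 4 ≤ k × Σ (Fin k → Fin n) λ f → Injective _≡_ _≡_ f ×
  (∀ i j → Adj G (f i) (f j) ⇔ CycConsec k i j)

module Submission where

-- Idea: grow an induced path v 0, v 1, …, v m by prepending vertices at v 0.
-- Since deg (v 0) ≥ 3, v 0 has two neighbours u ≠ w other than v 1.  For such
-- a neighbour x, let v (j+1) be the first vertex among v 1, …, v m adjacent
-- to x.  If there is none, x prepended to the path is a longer induced path.
-- If j = 0 then x, v 0, v 1 is a triangle.  If j ≥ 1 then x, v 0, …, v (j+1)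
-- is a hole of length j + 3; it is not a 4-hole (a 4-hole is a C₄), so it has
-- length at least 5.  If both u and w form triangles with v 0 v 1, then
-- u v 0 w v 1 is a C₄.  Induced paths have fewer vertices than the graph, so
-- the growth must stop at a hole.

open import Defs
open import Data.Nat using (ℕ; zero; suc; _≤_; _<_; _+_; _%_; z≤n; s≤s)
open import Data.Nat.Properties
  using (≤-refl; ≤-reflexive; ≤-trans; ≤-pred; <-irrefl; ≤⇒≯; ≰⇒>; m≤n⇒m<n∨m≡n;
         m<n⇒m<1+n; +-comm; +-suc; +-identityʳ; 0≢1+n)
open import Data.Nat.DivMod using (m<n⇒m%n≡m; n%n≡0)
open import Data.Fin using (Fin; toℕ; #_)
open import Data.Fin.Properties using (toℕ-injective; toℕ<n; pigeonhole)
open import Data.Fin.Properties using () renaming (_≟_ to _≟ᶠ_)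
open import Data.Product using (Σ; ∃-syntax; _×_; _,_)
open import Data.Sum using (_⊎_; inj₁; inj₂; swap)
import Data.Sum as Sum
open import Data.Empty using (⊥-elim)
open import Relation.Nullary using (¬_; Dec; yes; no)
open import Relation.Binary.PropositionalEquality
  using (_≡_; _≢_; refl; cong; trans; ≢-sym) renaming (sym to ≡-sym)
open import Function using (_∘_)
open import Function.Bundles using (Equivalence; mk⇔)
open import Data.List using (List; _∷_; filter; length)
open import Data.List.Base using (allFin)
open import Data.List.Relation.Unary.All using (All; _∷_)
open import Data.List.Relation.Unary.All.Properties using (all-filter)
open import Data.List.Relation.Unary.Unique.Propositional using (Unique)
open import Data.List.Relation.Unary.Unique.Propositional.Properties using (allFin⁺; filter⁺)
open import Data.List.Relation.Unary.AllPairs using (_∷_)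

least-below : {P : ℕ → Set} → (∀ j → Dec (P j)) → (m : ℕ) →
  (∀ j → j < m → ¬ P j) ⊎ ∃[ j ] (j < m × P j × (∀ i → i < j → ¬ P i))
least-below P? zero = inj₁ λ _ ()
least-below {P} P? (suc m) with least-below P? m
... | inj₂ (j , j<m , pj , below) = inj₂ (j , m<n⇒m<1+n j<m , pj , below)
... | inj₁ none with P? m
...   | yes pm = inj₂ (m , ≤-refl , pm , none)
...   | no ¬pm = inj₁ λ j j≤m → fails j (m≤n⇒m<n∨m≡n (≤-pred j≤m))
  where
  fails : ∀ j → j < m ⊎ j ≡ m → ¬ P j
  fails j (inj₁ j<m) = none j j<m
  fails j (inj₂ refl) = ¬pm

iterate-until : {P : ℕ → Set} {R : Set} (b : ℕ) →
  (∀ {m} → P m → m < b) → (∀ {m} → P m → P (suc m) ⊎ R) → P 0 → R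
iterate-until {P} {R} b bounded grow = run b ≤-refl
  where
  run : ∀ k {m} → b ≤ m + k → P m → R
  run zero {m} b≤m+0 p = ⊥-elim (≤⇒≯ (≤-trans b≤m+0 (≤-reflexive (+-identityʳ m))) (bounded p))
  run (suc k) {m} b≤ p with grow p
  ... | inj₁ p′ = run k (≤-trans b≤ (≤-reflexive (+-suc m k))) p′
  ... | inj₂ r = r

CycSucc : ℕ → ℕ → ℕ → Set
CycSucc K a b = suc a ≡ b ⊎ (suc a ≡ K × b ≡ 0)

cyc-succ⇒mod : ∀ {K a b} → b < suc K → CycSucc (suc K) a b → (a + 1) % suc K ≡ b
cyc-succ⇒mod {K} {a} b< (inj₁ refl) = trans (cong (_% suc K) (+-comm a 1)) (m<n⇒m%n≡m b<)
cyc-succ⇒mod {K} {a} _ (inj₂ (a+1≡K , refl)) =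
  trans (cong (_% suc K) (trans (+-comm a 1) a+1≡K)) (n%n≡0 (suc K))

mod⇒cyc-succ : ∀ {K a b} → a < suc K → (a + 1) % suc K ≡ b → CycSucc (suc K) a b
mod⇒cyc-succ {K} {a} a< e with m≤n⇒m<n∨m≡n a<
... | inj₁ a+1<K = inj₁ (trans (≡-sym (cyc-succ⇒mod a+1<K (inj₁ refl))) e)
... | inj₂ a+1≡K = inj₂ (a+1≡K , trans (≡-sym e) (cyc-succ⇒mod (s≤s z≤n) (inj₂ (a+1≡K , refl))))

_◂_ : ∀ {N} → Fin N → (ℕ → Fin N) → ℕ → Fin N
(x ◂ v) zero = x
(x ◂ v) (suc i) = v i

module Paths {N : ℕ} (G : Graph N) where

  adj⇒≢ : ∀ {a b} → Adj G a b → a ≢ b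
  adj⇒≢ a~b refl = irrefl G a~b

  cycle⇒hole : ∀ {K} (h : ℕ → Fin N) → 4 ≤ suc K →
    (∀ a b → a < suc K → b < suc K → h a ≡ h b → a ≡ b) →
    (∀ a b → a < suc K → b < suc K → Adj G (h a) (h b) → CycSucc (suc K) a b ⊎ CycSucc (suc K) b a) →
    (∀ a b → a < suc K → b < suc K → CycSucc (suc K) a b → Adj G (h a) (h b)) →
    HasHole G (suc K)
  cycle⇒hole {K} h 4≤K inj adj⇒cyc cyc⇒adj =
    4≤K , h ∘ toℕ , injective′ , λ i j → mk⇔ (adj⇒consec i j) (consec⇒adj i j)
    where
    injective′ : ∀ {i j} → h (toℕ i) ≡ h (toℕ j) → i ≡ j
    injective′ {i} {j} e = toℕ-injective (inj (toℕ i) (toℕ j) (toℕ<n i) (toℕ<n j) e)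
    adj⇒consec : ∀ i j → Adj G (h (toℕ i)) (h (toℕ j)) → CycConsec (suc K) i j
    adj⇒consec i j = Sum.map (cyc-succ⇒mod (toℕ<n j)) (cyc-succ⇒mod (toℕ<n i))
                   ∘ adj⇒cyc (toℕ i) (toℕ j) (toℕ<n i) (toℕ<n j)
    consec⇒adj : ∀ i j → CycConsec (suc K) i j → Adj G (h (toℕ i)) (h (toℕ j))
    consec⇒adj i j (inj₁ i→j) = cyc⇒adj (toℕ i) (toℕ j) (toℕ<n i) (toℕ<n j) (mod⇒cyc-succ (toℕ<n i) i→j)
    consec⇒adj i j (inj₂ j→i) =
      sym G (cyc⇒adj (toℕ j) (toℕ i) (toℕ<n j) (toℕ<n i) (mod⇒cyc-succ (toℕ<n j) j→i))

  hole4⇒C4 : HasHole G 4 → ContainsC4 G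
  hole4⇒C4 (_ , f , inj , adj) =
    f (# 0) , f (# 1) , f (# 2) , f (# 3) ,
    distinct (λ ()) , distinct (λ ()) , distinct (λ ()) ,
    distinct (λ ()) , distinct (λ ()) , distinct (λ ()) ,
    edge (inj₁ refl) , edge (inj₁ refl) , edge (inj₁ refl) , edge (inj₁ refl)
    where
    distinct : ∀ {i j} → i ≢ j → f i ≢ f j
    distinct i≢j = i≢j ∘ inj
    edge : ∀ {i j} → CycConsec 4 i j → Adj G (f i) (f j)
    edge {i} {j} = Equivalence.from (adj i j)

  record InducedPath (m : ℕ) : Set where
    field
      vertex    : ℕ → Fin N
      injective : ∀ i j → i ≤ m → j ≤ m → vertex i ≡ vertex j → i ≡ j
      chordless : ∀ i j → i ≤ m → j ≤ m → Adj G (vertex i) (vertex j) → suc i ≡ j ⊎ suc j ≡ i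
      edge      : ∀ i → i < m → Adj G (vertex i) (vertex (suc i))

  open InducedPath

  trivial-path : Fin N → InducedPath 0
  trivial-path x = record
    { vertex = λ _ → x
    ; injective = λ { zero zero _ _ _ → refl }
    ; chordless = λ _ _ _ _ x~x → ⊥-elim (irrefl G x~x)
    ; edge = λ _ ()
    }

  length-bound : ∀ {m} → InducedPath m → m < N
  length-bound {m} p = ≰⇒> too-long
    where
    too-long : ¬ N ≤ m
    too-long N≤m with pigeonhole (s≤s N≤m) (vertex p ∘ toℕ)
    ... | i , j , i<j , vi≡vj =
      <-irrefl (injective p (toℕ i) (toℕ j) (≤-pred (toℕ<n i)) (≤-pred (toℕ<n j)) vi≡vj) i<j

  prefix : ∀ {m l} → InducedPath m → l ≤ m → InducedPath l
  prefix p l≤m = record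
    { vertex = vertex p
    ; injective = λ i j i≤ j≤ → injective p i j (≤-trans i≤ l≤m) (≤-trans j≤ l≤m)
    ; chordless = λ i j i≤ j≤ → chordless p i j (≤-trans i≤ l≤m) (≤-trans j≤ l≤m)
    ; edge = λ i i< → edge p i (≤-trans i< l≤m)
    }

  -- A neighbour of the start v 0 other than v 1 lies off the path: being on
  -- it at v i with i ≥ 2 would make v 0 v i a chord.
  off-path : ∀ {m x} (p : InducedPath m) → Adj G x (vertex p 0) → x ≢ vertex p 1 →
    ∀ i → i ≤ m → x ≢ vertex p i
  off-path p x~v0 x≢v1 zero _ refl = irrefl G x~v0
  off-path p x~v0 x≢v1 (suc zero) _ = x≢v1
  off-path p x~v0 x≢v1 (suc (suc i)) i≤m refl
    with chordless p (suc (suc i)) 0 i≤m z≤n x~v0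
  ... | inj₁ ()
  ... | inj₂ ()

  Misses : ∀ {m} → Fin N → InducedPath m → ℕ → Set
  Misses x p l = ∀ i → i < l → ¬ Adj G x (vertex p (suc i))

  misses⇒start : ∀ {m x l i} (p : InducedPath m) → Misses x p l → i ≤ l →
    Adj G x (vertex p i) → i ≡ 0
  misses⇒start {i = zero} p misses _ _ = refl
  misses⇒start {i = suc i} p misses i<l x~vi = ⊥-elim (misses i i<l x~vi)

  prepend-injective : ∀ {m x} (p : InducedPath m) → Adj G x (vertex p 0) → x ≢ vertex p 1 →
    ∀ i j → i ≤ suc m → j ≤ suc m → (x ◂ vertex p) i ≡ (x ◂ vertex p) j → i ≡ j
  prepend-injective p x~v0 x≢v1 zero zero _ _ _ = refl
  prepend-injective p x~v0 x≢v1 zero (suc j) _ (s≤s j≤m) e = ⊥-elim (off-path p x~v0 x≢v1 j j≤m e)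
  prepend-injective p x~v0 x≢v1 (suc i) zero (s≤s i≤m) _ e =
    ⊥-elim (off-path p x~v0 x≢v1 i i≤m (≡-sym e))
  prepend-injective p x~v0 x≢v1 (suc i) (suc j) (s≤s i≤m) (s≤s j≤m) e =
    cong suc (injective p i j i≤m j≤m e)

  prepend : ∀ {m x} (p : InducedPath m) → Adj G x (vertex p 0) → x ≢ vertex p 1 →
    Misses x p m → InducedPath (suc m)
  prepend {m} {x} p x~v0 x≢v1 misses = record
    { vertex = x ◂ vertex p
    ; injective = prepend-injective p x~v0 x≢v1
    ; chordless = chords
    ; edge = λ { zero _ → x~v0 ; (suc i) (s≤s i<m) → edge p i i<m }
    }
    where
    chords : ∀ i j → i ≤ suc m → j ≤ suc m → Adj G ((x ◂ vertex p) i) ((x ◂ vertex p) j) →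
      suc i ≡ j ⊎ suc j ≡ i
    chords zero zero _ _ x~x = ⊥-elim (irrefl G x~x)
    chords zero (suc j) _ (s≤s j≤m) x~vj = inj₁ (cong suc (≡-sym (misses⇒start p misses j≤m x~vj)))
    chords (suc i) zero (s≤s i≤m) _ vi~x =
      inj₂ (cong suc (≡-sym (misses⇒start p misses i≤m (sym G vi~x))))
    chords (suc i) (suc j) (s≤s i≤m) (s≤s j≤m) vi~vj =
      Sum.map (cong suc) (cong suc) (chordless p i j i≤m j≤m vi~vj)

  close-path : ∀ {j x} (p : InducedPath (suc j)) → 1 ≤ j →
    Adj G x (vertex p 0) → Adj G x (vertex p (suc j)) → x ≢ vertex p 1 → Misses x p j →
    HasHole G (suc (suc (suc j)))
  close-path {j} {x} p 1≤j x~v0 x~end x≢v1 misses =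
    cycle⇒hole h (s≤s (s≤s (s≤s 1≤j))) inj adj⇒cyc cyc⇒adj
    where
    h : ℕ → Fin N
    h = x ◂ vertex p
    ends : ∀ i → i ≤ suc j → Adj G x (vertex p i) → i ≡ 0 ⊎ i ≡ suc j
    ends i i≤ x~vi with m≤n⇒m<n∨m≡n i≤
    ... | inj₁ i<end = inj₁ (misses⇒start p misses (≤-pred i<end) x~vi)
    ... | inj₂ i≡end = inj₂ i≡end
    x-cyc : ∀ i → i ≤ suc j → Adj G x (vertex p i) →
      CycSucc (suc (suc (suc j))) 0 (suc i) ⊎ CycSucc (suc (suc (suc j))) (suc i) 0
    x-cyc i i≤ x~vi with ends i i≤ x~vi
    ... | inj₁ refl = inj₁ (inj₁ refl)
    ... | inj₂ refl = inj₂ (inj₂ (refl , refl))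
    inj : ∀ a b → a < suc (suc (suc j)) → b < suc (suc (suc j)) → h a ≡ h b → a ≡ b
    inj a b (s≤s a≤) (s≤s b≤) = prepend-injective p x~v0 x≢v1 a b a≤ b≤
    adj⇒cyc : ∀ a b → a < suc (suc (suc j)) → b < suc (suc (suc j)) → Adj G (h a) (h b) →
      CycSucc (suc (suc (suc j))) a b ⊎ CycSucc (suc (suc (suc j))) b a
    adj⇒cyc zero zero _ _ x~x = ⊥-elim (irrefl G x~x)
    adj⇒cyc zero (suc i) _ (s≤s (s≤s i≤)) x~vi = x-cyc i i≤ x~vi
    adj⇒cyc (suc i) zero (s≤s (s≤s i≤)) _ vi~x = swap (x-cyc i i≤ (sym G vi~x))
    adj⇒cyc (suc i) (suc i′) (s≤s (s≤s i≤)) (s≤s (s≤s i′≤)) vi~vi′ =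
      Sum.map (inj₁ ∘ cong suc) (inj₁ ∘ cong suc) (chordless p i i′ i≤ i′≤ vi~vi′)
    cyc⇒adj : ∀ a b → a < suc (suc (suc j)) → b < suc (suc (suc j)) →
      CycSucc (suc (suc (suc j))) a b → Adj G (h a) (h b)
    cyc⇒adj zero _ _ _ (inj₁ refl) = x~v0
    cyc⇒adj (suc i) _ _ (s≤s (s≤s i<)) (inj₁ refl) = edge p i i<
    cyc⇒adj (suc i) zero _ _ (inj₂ (refl , refl)) = sym G x~end

three-distinct : ∀ {A : Set} {P : A → Set} (xs : List A) → 3 ≤ length xs → All P xs → Unique xs →
  ∃[ a ] ∃[ b ] ∃[ c ] (a ≢ b × a ≢ c × b ≢ c × P a × P b × P c)
three-distinct (a ∷ b ∷ c ∷ _) (s≤s (s≤s (s≤s _))) (pa ∷ pb ∷ pc ∷ _)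
  ((a≢b ∷ a≢c ∷ _) ∷ (b≢c ∷ _) ∷ _) = a , b , c , a≢b , a≢c , b≢c , pa , pb , pc

two-neighbours-avoiding : ∀ {N} (G : Graph N) (v y : Fin N) → 3 ≤ degree G v →
  ∃[ u ] ∃[ w ] (u ≢ w × Adj G v u × Adj G v w × u ≢ y × w ≢ y)
two-neighbours-avoiding {N} G v y deg≥3
  with three-distinct (filter (adj? G v) (allFin N)) deg≥3
         (all-filter (adj? G v) (allFin N)) (filter⁺ (adj? G v) (allFin⁺ N))
... | a , b , c , a≢b , a≢c , b≢c , v~a , v~b , v~c with a ≟ᶠ y | b ≟ᶠ y
...   | yes refl | _ = b , c , b≢c , v~b , v~c , ≢-sym a≢b , ≢-sym a≢c
...   | no a≢y | yes refl = a , c , a≢c , v~a , v~c , a≢y , ≢-sym b≢c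
...   | no a≢y | no b≢y = a , b , a≢b , v~a , v~b , a≢y , b≢y

module MinDegreeThreeC4Free {N : ℕ} (G : Graph N)
    (min-degree : MinDegreeAtLeast G 3) (no-C4 : ¬ ContainsC4 G) where
  open Paths G
  open InducedPath

  LongHole : Set
  LongHole = Σ ℕ λ k → 5 ≤ k × HasHole G k

  long-hole : ∀ {k} → HasHole G k → LongHole
  long-hole {k} hole@(4≤k , _) with m≤n⇒m<n∨m≡n 4≤k
  ... | inj₁ 5≤k = k , 5≤k , hole
  ... | inj₂ refl = ⊥-elim (no-C4 (hole4⇒C4 hole))

  data Attachment {m} (p : InducedPath m) (x : Fin N) : Set where
    extends  : InducedPath (suc m) → Attachment p x
    hole     : LongHole → Attachment p x
    triangle : 0 < m → Adj G x (vertex p 1) → Attachment p x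

  attach : ∀ {m x} (p : InducedPath m) → Adj G x (vertex p 0) → x ≢ vertex p 1 → Attachment p x
  attach {m} {x} p x~v0 x≢v1 with least-below (λ j → adj? G x (vertex p (suc j))) m
  ... | inj₁ misses = extends (prepend p x~v0 x≢v1 misses)
  ... | inj₂ (zero , 0<m , x~v1 , _) = triangle 0<m x~v1
  ... | inj₂ (suc j , j+1<m , x~end , misses) =
    hole (long-hole (close-path (prefix p j+1<m) (s≤s z≤n) x~v0 x~end x≢v1 misses))

  grow : ∀ {m} → InducedPath m → InducedPath (suc m) ⊎ LongHole
  grow p with two-neighbours-avoiding G (vertex p 0) (vertex p 1) (min-degree (vertex p 0))
  ... | u , w , u≢w , v0~u , v0~w , u≢v1 , w≢v1
    with attach p (sym G v0~u) u≢v1 | attach p (sym G v0~w) w≢v1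
  ... | extends q | _ = inj₁ q
  ... | hole H | _ = inj₂ H
  ... | triangle _ _ | extends q = inj₁ q
  ... | triangle _ _ | hole H = inj₂ H
  ... | triangle 0<m u~v1 | triangle _ w~v1 =
    ⊥-elim (no-C4 (u , vertex p 0 , w , vertex p 1 ,
      ≢-sym (adj⇒≢ v0~u) , u≢w , u≢v1 , adj⇒≢ v0~w ,
      0≢1+n ∘ injective p 0 1 z≤n 0<m , w≢v1 ,
      sym G v0~u , v0~w , w~v1 , sym G u~v1))

lemma2 : ∀ {n} (G : Graph (suc n)) → MinDegreeAtLeast G 3 → ¬ ContainsC4 G →
    Σ ℕ λ k → 5 ≤ k × HasHole G k
lemma2 {n} G min-degree no-C4 =
  iterate-until (suc n) length-bound grow (trivial-path (# 0))
  where
  open Paths G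
  open MinDegreeThreeC4Free G min-degree no-C4
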